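{- Consider the auction algorithm described in the context, run on a weighted bipartite graph $G=(U\cup V,E)$ with parameter $\varepsilon>0$, and let $P$ be the total number of moves. For all $p\in[P]$ and all $(u,v)\in\mathcal{M}_p$, $$L_p(v)\le \min_{v'\in N(u)\setminus\{v\}}\big(L_p(v')+w(u,v')\big)-w(u,v)+\varepsilon.$$
   Context: $G=(U\cup V,E)$ is bipartite with $|U|\le|V|=n$, weights $w:E\to\mathbb{R}$, maximum/minimum edge weights $w^{max},w^{min}$, and $N(u)\subseteq V$ the neighbours of $u\in U$. The algorithm keeps for each $v\in V$ a label $L(v)$ and assigned vertex $T(v)\in U\cup\{\emptyset\}$, initially $L(v)=0$, $T(v)=\emptyset$, and processes each $u\in U$ by MatchVertex$(u)$: (1) choose $v\in N(u)$ minimizing $L(v)+w(u,v)$; (2) if $L(v)>\frac n2(w^{max}-w^{min}+\varepsilon)$, return; (3) set $L(v)\leftarrow \min_{v'\in N(u)\setminus\{v\}}(L(v')+w(u,v'))-w(u,v)+\varepsilon$; (4) if $T(v)=y\ne\emptyset$, set $T(v)\leftarrow u$ and call MatchVertex$(y)$, else set $T(v)\leftarrow u$. A move is an assignment of an edge $(u,v)$ to $v$ (to a free vertex or replacing its previously assigned edge). $L_p(v)$ is the label of $v$ at the end of the $p$-th move, and $\mathcal{M}_p=\{(T(v),v):T(v)\neq\emptyset\}$ is the set of matched edges at the end of the $p$-th move.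
   Formalization: The edge weights $w$, the parameter $\varepsilon$ and the labels $L(v)$ are rational (labels may also be +∞) instead of real. -}

module Defs where

open import Data.Nat using (ℕ)
open import Data.Integer using (+_)
open import Data.Rational using (ℚ; _+_; _-_; _*_; _/_; 0ℚ) renaming (_≤_ to _≤ℚ_; _<_ to _<ℚ_)
open import Data.Fin using (Fin; _≟_)
open import Data.Fin.Base using ()
open import Data.List using (List; []; _∷_; allFin; foldr)
open import Data.Bool using (Bool; true; false; if_then_else_; _∧_; not)
open import Data.Maybe using (Maybe; just; nothing)
open import Data.Product using (Σ; _×_; _,_)
open import Relation.Nullary.Decidable using (⌊_⌋)
open import Relation.Binary.PropositionalEquality using (_≡_)

-- Extended rationals ℚ ∪ {+∞}: the minimum over an empty set is +∞.

data ℚ∞ : Set where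
  fin : ℚ → ℚ∞
  ∞   : ℚ∞

_+∞_ : ℚ∞ → ℚ → ℚ∞
fin a +∞ q = fin (a + q)
∞     +∞ q = ∞

data _≤∞_ : ℚ∞ → ℚ∞ → Set where
  fin≤fin : ∀ {a b} → a ≤ℚ b → fin a ≤∞ fin b
  x≤∞     : ∀ {x} → x ≤∞ ∞

data _<∞_ : ℚ∞ → ℚ∞ → Set where
  fin<fin : ∀ {a b} → a <ℚ b → fin a <∞ fin b
  fin<∞   : ∀ {a} → fin a <∞ ∞

min∞ : ℚ∞ → ℚ∞ → ℚ∞
min∞ ∞ y = y
min∞ x ∞ = x
min∞ (fin a) (fin b) = fin (Data.Rational._⊓_ a b)

-- Bipartite graph: U = Fin m, V = Fin n, edge set given by adj,
-- weights w (only relevant on edges).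

IsMaxWeight : ∀ {m n} → (Fin m → Fin n → Bool) → (Fin m → Fin n → ℚ) → ℚ → Set
IsMaxWeight adj w x =
  (∀ u v → adj u v ≡ true → w u v ≤ℚ x) ×
  Σ _ (λ u → Σ _ (λ v → adj u v ≡ true × w u v ≡ x))

IsMinWeight : ∀ {m n} → (Fin m → Fin n → Bool) → (Fin m → Fin n → ℚ) → ℚ → Set
IsMinWeight adj w x =
  (∀ u v → adj u v ≡ true → x ≤ℚ w u v) ×
  Σ _ (λ u → Σ _ (λ v → adj u v ≡ true × w u v ≡ x))

threshold : ℕ → ℚ → ℚ → ℚ → ℚ
threshold n wmax wmin ε = ((+ n) / 2) * ((wmax - wmin) + ε)

update : ∀ {n} {A : Set} → (Fin n → A) → Fin n → A → Fin n → A
update f v a x = if ⌊ x ≟ v ⌋ then a else f x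

-- Algorithm state: labels L, assignment T, the vertex currently being
-- processed by MatchVertex (if any), and the U-vertices not yet started.

record State (m n : ℕ) : Set where
  constructor ⟨_,_,_,_⟩
  field
    L       : Fin n → ℚ∞
    T       : Fin n → Maybe (Fin m)
    cur     : Maybe (Fin m)
    pending : List (Fin m)

initState : (m n : ℕ) → State m n
initState m n = ⟨ (λ _ → fin 0ℚ) , (λ _ → nothing) , nothing , allFin m ⟩

module Auction {m n : ℕ} (adj : Fin m → Fin n → Bool)
               (w : Fin m → Fin n → ℚ) (ε θ : ℚ) where

  minOther : (Fin n → ℚ∞) → Fin m → Fin n → ℚ∞
  minOther L u v =
    foldr (λ v' acc → if adj u v' ∧ not ⌊ v' ≟ v ⌋
                        then min∞ (L v' +∞ w u v') acc else acc)
          ∞ (allFin n)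

  newLabel : (Fin n → ℚ∞) → Fin m → Fin n → ℚ∞
  newLabel L u v = minOther L u v +∞ (ε - w u v)

  IsChoice : (Fin n → ℚ∞) → Fin m → Fin n → Set
  IsChoice L u v = adj u v ≡ true ×
    (∀ v' → adj u v' ≡ true → (L v +∞ w u v) ≤∞ (L v' +∞ w u v'))

  -- a move: steps (3),(4); afterwards MatchVertex continues with the
  -- previously assigned vertex T(v) (if any)
  data Move : State m n → State m n → Set where
    move : ∀ {L T u us v} → IsChoice L u v → L v ≤∞ fin θ →
           Move ⟨ L , T , just u , us ⟩
                ⟨ update L v (newLabel L u v) , update T v (just u) , T v , us ⟩

  data Step : State m n → State m n → Set where
    start  : ∀ {L T u us} →
             Step ⟨ L , T , nothing , u ∷ us ⟩ ⟨ L , T , just u , us ⟩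
    noNbr  : ∀ {L T u us} → (∀ v → adj u v ≡ false) →
             Step ⟨ L , T , just u , us ⟩ ⟨ L , T , nothing , us ⟩
    stop   : ∀ {L T u us v} → IsChoice L u v → fin θ <∞ L v →
             Step ⟨ L , T , just u , us ⟩ ⟨ L , T , nothing , us ⟩
    moveS  : ∀ {s s'} → Move s s' → Step s s'

{-# OPTIONS --safe #-}
-- A move only raises labels: the new label of v is at least L(v) because v minimised
-- L(v') + w(u,v') over N(u) and ε ≥ 0.  Since min_{v' ≠ v}(L(v') + w(u,v')) is monotone
-- in the labels, the inequality, which holds with equality for the edge just assigned,
-- persists for every assigned edge as long as labels only grow.
module Submission where

open import Defs
open import Data.Nat using (ℕ; _≤_)
open import Data.Rational using (ℚ; 0ℚ; _+_; _-_) renaming (_≤_ to _≤ℚ_; _<_ to _<ℚ_)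
import Data.Rational.Properties as ℚ
open import Data.Rational.Solver using (module +-*-Solver)
open import Data.Fin using (Fin; _≟_)
open import Data.Bool using (Bool; true; false; if_then_else_)
open import Data.Bool.Properties using (∧-conicalˡ)
open import Data.List using (List; []; _∷_; foldr; allFin)
open import Data.Maybe using (just)
open import Data.Product using (proj₂)
open import Function using (_∘_; id)
open import Relation.Nullary using (yes; no)
open import Relation.Binary.PropositionalEquality using (_≡_; refl)
open import Relation.Binary.Construct.Closure.ReflexiveTransitive using (Star; fold)

≤∞-refl : ∀ {x} → x ≤∞ x
≤∞-refl {fin a} = fin≤fin ℚ.≤-refl
≤∞-refl {∞}     = x≤∞

≤∞-trans : ∀ {x y z} → x ≤∞ y → y ≤∞ z → x ≤∞ z
≤∞-trans (fin≤fin p) (fin≤fin q) = fin≤fin (ℚ.≤-trans p q)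
≤∞-trans _           x≤∞         = x≤∞

+∞-monoˡ-≤∞ : ∀ {x y} q → x ≤∞ y → (x +∞ q) ≤∞ (y +∞ q)
+∞-monoˡ-≤∞ q (fin≤fin p) = fin≤fin (ℚ.+-monoˡ-≤ q p)
+∞-monoˡ-≤∞ q x≤∞         = x≤∞

min∞-mono-≤∞ : ∀ {x y x' y'} → x ≤∞ x' → y ≤∞ y' → min∞ x y ≤∞ min∞ x' y'
min∞-mono-≤∞ {∞}                              x≤∞         q           = q
min∞-mono-≤∞ {fin a} {∞}     {fin _} {∞}     p           _           = p
min∞-mono-≤∞ {fin a} {∞}     {∞}     {∞}     _           _           = x≤∞
min∞-mono-≤∞ {fin a} {fin b} {fin _} {fin _} (fin≤fin p) (fin≤fin q) = fin≤fin (ℚ.⊓-mono-≤ p q)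
min∞-mono-≤∞ {fin a} {fin b} {fin _} {∞}     (fin≤fin p) _           = fin≤fin (ℚ.≤-trans (ℚ.p⊓q≤p a b) p)
min∞-mono-≤∞ {fin a} {fin b} {∞}     {fin _} _           (fin≤fin q) = fin≤fin (ℚ.≤-trans (ℚ.p⊓q≤q a b) q)
min∞-mono-≤∞ {fin a} {fin b} {∞}     {∞}     _           _           = x≤∞

min∞-glb : ∀ {z x y} → z ≤∞ x → z ≤∞ y → z ≤∞ min∞ x y
min∞-glb {x = ∞}                    _           q           = q
min∞-glb {x = fin _} {∞}     p           _           = p
min∞-glb {x = fin _} {fin _} (fin≤fin p) (fin≤fin q) = fin≤fin (ℚ.⊓-glb p q)

p+q≤r⇒p≤r+[e-q] : ∀ {p q r e} → 0ℚ ≤ℚ e → p + q ≤ℚ r → p ≤ℚ r + (e - q)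
p+q≤r⇒p≤r+[e-q] {p} {q} {r} {e} 0≤e p+q≤r = begin
  p                  ≡⟨ ℚ.+-identityʳ p ⟨
  p + 0ℚ             ≤⟨ ℚ.+-monoʳ-≤ p 0≤e ⟩
  p + e              ≡⟨ shift ⟩
  (p + q) + (e - q)  ≤⟨ ℚ.+-monoˡ-≤ (e - q) p+q≤r ⟩
  r + (e - q)        ∎
  where
  open ℚ.≤-Reasoning
  open +-*-Solver
  shift : p + e ≡ (p + q) + (e - q)
  shift = solve 3 (λ p q e → p :+ e := (p :+ q) :+ (e :- q)) refl p q e

x+q≤y⇒x≤y+[e-q] : ∀ {x q e y} → 0ℚ ≤ℚ e → (x +∞ q) ≤∞ y → x ≤∞ (y +∞ (e - q))
x+q≤y⇒x≤y+[e-q] {fin _} 0≤e (fin≤fin p) = fin≤fin (p+q≤r⇒p≤r+[e-q] 0≤e p)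
x+q≤y⇒x≤y+[e-q] {fin _} 0≤e x≤∞         = x≤∞
x+q≤y⇒x≤y+[e-q] {∞}     0≤e x≤∞         = x≤∞

-- Auction.minOther L u v unfolds to minOver (N(u) ∖ {v}) (λ v' → L v' +∞ w u v') (allFin n).
module _ {A : Set} (p : A → Bool) where

  minOver : (A → ℚ∞) → List A → ℚ∞
  minOver f = foldr (λ x acc → if p x then min∞ (f x) acc else acc) ∞

  minOver-mono-≤∞ : ∀ {f g} → (∀ x → f x ≤∞ g x) → ∀ xs → minOver f xs ≤∞ minOver g xs
  minOver-mono-≤∞ f≤g []       = x≤∞
  minOver-mono-≤∞ f≤g (x ∷ xs) with p x
  ... | true  = min∞-mono-≤∞ (f≤g x) (minOver-mono-≤∞ f≤g xs)
  ... | false = minOver-mono-≤∞ f≤g xs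

  minOver-glb : ∀ {z f} → (∀ x → p x ≡ true → z ≤∞ f x) → ∀ xs → z ≤∞ minOver f xs
  minOver-glb z≤f []       = x≤∞
  minOver-glb z≤f (x ∷ xs) with p x in px
  ... | true  = min∞-glb (z≤f x px) (minOver-glb z≤f xs)
  ... | false = minOver-glb z≤f xs

module _ {m n : ℕ} (adj : Fin m → Fin n → Bool) (w : Fin m → Fin n → ℚ)
         (ε θ : ℚ) (0≤ε : 0ℚ ≤ℚ ε) where

  open Auction adj w ε θ

  Labels : Set
  Labels = Fin n → ℚ∞

  _≤ᴸ_ : Labels → Labels → Set
  L ≤ᴸ L' = ∀ x → L x ≤∞ L' x

  newLabel-mono : ∀ {L L'} → L ≤ᴸ L' → ∀ u v → newLabel L u v ≤∞ newLabel L' u v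
  newLabel-mono L≤L' u v =
    +∞-monoˡ-≤∞ (ε - w u v) (minOver-mono-≤∞ _ (+∞-monoˡ-≤∞ _ ∘ L≤L') (allFin n))

  choice≤minOther : ∀ {L u v} → IsChoice L u v → (L v +∞ w u v) ≤∞ minOther L u v
  choice≤minOther {u = u} choice =
    minOver-glb _ (λ x px → proj₂ choice x (∧-conicalˡ (adj u x) _ px)) (allFin n)

  label≤newLabel : ∀ {L u v} → IsChoice L u v → L v ≤∞ newLabel L u v
  label≤newLabel choice = x+q≤y⇒x≤y+[e-q] 0≤ε (choice≤minOther choice)

  move-raises-labels : ∀ {L u v} → IsChoice L u v → L ≤ᴸ update L v (newLabel L u v)
  move-raises-labels {v = v} choice x with x ≟ v
  ... | yes refl = label≤newLabel choice
  ... | no _     = ≤∞-refl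

  εCS : State m n → Set
  εCS s = ∀ u v → State.T s v ≡ just u → State.L s v ≤∞ newLabel (State.L s) u v

  εCS-initState : εCS (initState m n)
  εCS-initState u v ()

  εCS-move : ∀ {s s'} → Move s s' → εCS s → εCS s'
  εCS-move (move {u = u} {v = v} choice _) cs u' x T'x≡u' with x ≟ v | T'x≡u'
  ... | yes refl | refl  = newLabel-mono (move-raises-labels choice) u v
  ... | no _     | Tx≡u' = ≤∞-trans (cs u' x Tx≡u') (newLabel-mono (move-raises-labels choice) u' x)

  εCS-step : ∀ {s s'} → Step s s' → εCS s → εCS s'
  εCS-step start      = id
  εCS-step (noNbr _)  = id
  εCS-step (stop _ _) = id
  εCS-step (moveS mv) = εCS-move mv

  εCS-star : ∀ {s s'} → Star Step s s' → εCS s → εCS s'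
  εCS-star = fold (λ s s' → εCS s → εCS s') (λ step rest → rest ∘ εCS-step step) id

proposition2 : (m n : ℕ) → m ≤ n →
    (adj : Fin m → Fin n → Bool) (w : Fin m → Fin n → ℚ) (wmax wmin ε : ℚ) →
    IsMaxWeight adj w wmax → IsMinWeight adj w wmin → 0ℚ <ℚ ε →
    (s s' : State m n) →
    Star (Auction.Step adj w ε (threshold n wmax wmin ε)) (initState m n) s →
    Auction.Move adj w ε (threshold n wmax wmin ε) s s' →
    ∀ u v → State.T s' v ≡ just u →
    State.L s' v ≤∞ (Auction.minOther adj w ε (threshold n wmax wmin ε) (State.L s') u v +∞ (ε - w u v))
proposition2 m n _ adj w wmax wmin ε _ _ 0<ε s s' run mv =
  εCS-move adj w ε θ 0≤ε mv (εCS-star adj w ε θ 0≤ε run (εCS-initState adj w ε θ 0≤ε))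
  where
  θ   = threshold n wmax wmin ε
  0≤ε = ℚ.<⇒≤ 0<ε
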